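{- Let $x,y$ be groves of positive degree. Then: (1) $C(x+y)\ge 2C(x)C(y)$, with equality if and only if $x$ is left-inherited and $y$ is right-inherited; (2) $C(x\times y)\ge C(x)\,C(y)^{\deg(x)}$.
   Context: A (planar binary) tree of degree $n$ is a rooted planar binary tree with $n$ trivalent internal vertices and $n+1$ leaves, drawn growing upward from its root, considered up to planar isotopy; $Y_n$ is the set of trees of degree $n$. $\underline{0}$ is the unique tree of degree $0$ and $\underline{1}$ the unique tree of degree $1$. A grove of degree $n$ is a nonempty subset of $Y_n$; a tree is identified with the one-element grove; $\deg$ denotes degree. For trees $x,y$, the graft $x\vee y$ attaches the root of $x$ to the left leaf and the root of $y$ to the right leaf of $\underline{1}$; every tree $x$ of positive degree is uniquely $x=x^l\vee x^r$. For $x\in Y_p,y\in Y_q$, $x/y\in Y_{p+q}$ identifies the root of $x$ with the leftmost leaf of $y$, and $x\backslash y\in Y_{p+q}$ identifies the rightmost leaf of $x$ with the root of $y$. $Y_n$ carries the Tamari partial order generated by $(a\vee b)\vee c\le a\vee(b\vee c)$ and compatibility with grafting. The sum of trees is the grove $x+y=\{z: x/y\le z\le x\backslash y\}$, extended to groves by $x+y=\bigcup_{i,j}(x_i+y_j)$. Left sum $x\dashv y=x^l\vee(x^r+y)$, right sum $x\vdash y=(x+y^l)\vee y^r$ for trees (grafting with a grove giving the grove of grafts; convention $x\vdash\underline{0}=\underline{0}\dashv y=\underline{0}$), extended to groves by unions; for trees of positive degree $x+y=(x\dashv y)\cup(x\vdash y)$. Product: for a tree $x$ of positive degree and a grove $y$,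 $\underline{1}\times y=y$ and for $x=x^l\vee x^r$, $x\times y=(x^l\times y)\vdash y\dashv(x^r\times y)$, where the factor $(x^l\times y)\vdash$ is omitted if $x^l=\underline{0}$ and $\dashv(x^r\times y)$ is omitted if $x^r=\underline{0}$ (the two parenthesizations agree); equivalently, $x\times y$ is obtained by writing $x$ as its universal expression, an iterated left/right sum of $\deg x$ copies of $\underline{1}$, and substituting $y$ for each $\underline{1}$. For a grove $x$, $x\times y=\bigcup_i(x_i\times y)$. The count $C(x)$ of a grove is its cardinality. A tree $x$ is left-inherited if $x^r=\underline{0}$, right-inherited if $x^l=\underline{0}$; a grove is left/right-inherited if all its trees are. -}

module Defs where

open import Data.Nat using (ℕ; zero; suc; _+_; _*_; _^_; _≤_)
open import Data.List using (List; []; length)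
open import Data.List.Membership.Propositional using (_∈_)
open import Data.List.Relation.Unary.All using (All)
open import Data.List.Relation.Unary.Unique.Propositional using (Unique)
open import Data.Product using (Σ; ∃; ∃-syntax; _×_; _,_)
open import Data.Empty using (⊥)
open import Relation.Binary.PropositionalEquality using (_≡_; _≢_)
open import Function.Bundles using (_⇔_)

-- Planar binary trees: leaf = the tree 0 of degree 0; node l r = l ∨ r (graft).
data Tree : Set where
  leaf : Tree
  node : Tree → Tree → Tree

infixr 6 _∨_
_∨_ : Tree → Tree → Tree
_∨_ = node

degree : Tree → ℕ
degree leaf = 0
degree (node l r) = suc (degree l + degree r)

-- x / y : root of x identified with the leftmost leaf of y
_over_ : Tree → Tree → Tree
x over leaf = x
x over node l r = node (x over l) r

-- x \ y : rightmost leaf of x identified with the root of y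
_under_ : Tree → Tree → Tree
leaf under y = y
node l r under y = node l (r under y)

infix 4 _≤T_
data _≤T_ : Tree → Tree → Set where
  ≤T-refl  : ∀ {a} → a ≤T a
  ≤T-trans : ∀ {a b c} → a ≤T b → b ≤T c → a ≤T c
  ≤T-rot   : ∀ {a b c} → (a ∨ b) ∨ c ≤T a ∨ (b ∨ c)
  ≤T-congˡ : ∀ {a a' b} → a ≤T a' → a ∨ b ≤T a' ∨ b
  ≤T-congʳ : ∀ {a b b'} → b ≤T b' → a ∨ b ≤T a ∨ b'

TSet : Set₁
TSet = Tree → Set

sumT : Tree → Tree → TSet
sumT x y z = (x over y ≤T z) × (z ≤T x under y)

lsumT : Tree → Tree → TSet
lsumT leaf y z = z ≡ leaf
lsumT (node xl xr) y z = ∃[ w ] (sumT xr y w × z ≡ node xl w)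

rsumT : Tree → Tree → TSet
rsumT x leaf z = z ≡ leaf
rsumT x (node yl yr) z = ∃[ w ] (sumT x yl w × z ≡ node w yr)

liftS : (Tree → Tree → TSet) → TSet → TSet → TSet
liftS op X Y z = ∃[ a ] ∃[ b ] (X a × Y b × op a b z)

sumS lsumS rsumS : TSet → TSet → TSet
sumS  = liftS sumT
lsumS = liftS lsumT
rsumS = liftS rsumT

-- product of a tree of positive degree with a set of trees
-- x × y = (x^l × y) ⊢ y ⊣ (x^r × y), omitting factors whose tree is 0
prodT : Tree → TSet → TSet
prodT leaf y z = ⊥   -- degree 0: not used
prodT (node leaf leaf) y = y
prodT (node leaf r) y = lsumS y (prodT r y)
prodT (node l leaf) y = rsumS (prodT l y) y
prodT (node l r) y = lsumS (rsumS (prodT l y) y) (prodT r y)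

prodS : TSet → TSet → TSet
prodS X Y z = ∃[ a ] (X a × prodT a Y z)

record Grove : Set where
  field
    deg      : ℕ
    trees    : List Tree
    nonempty : trees ≢ []
    unique   : Unique trees
    degrees  : All (λ t → degree t ≡ deg) trees

open Grove public

mem : Grove → TSet
mem x t = t ∈ trees x

C : Grove → ℕ
C x = length (trees x)

IsCard : TSet → ℕ → Set
IsCard P k = Σ (List Tree) λ L → Unique L × (∀ z → (z ∈ L) ⇔ P z) × length L ≡ k

LeftInheritedT RightInheritedT : Tree → Set
LeftInheritedT t = ∃[ l ] (t ≡ node l leaf)
RightInheritedT t = ∃[ r ] (t ≡ node leaf r)

LeftInherited RightInherited : Grove → Set
LeftInherited x = All LeftInheritedT (trees x)
RightInherited x = All RightInheritedT (trees x)

-- (1) For a, b of positive degree the extremes a/b and a\b of a + b are distinct, and degrees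
-- show that (a, b) ↦ {a/b, a\b} is injective, so x + y has at least 2 C(x) C(y) elements.
-- If some a = al ∨ ar ∈ x has ar ≠ 0, then al ∨ (ar/b) is a further element of a + b that is
-- no extreme of any pair; dually (a\bl) ∨ br if some b = bl ∨ br ∈ y has bl ≠ 0. Conversely, for
-- a = al ∨ 0 and b = 0 ∨ br, going up in the Tamari order left spines only lose subtrees and
-- right spines only gain them, so every z in a + b keeps al on its left spine and br on its
-- right spine, and a degree count leaves only a/b and a\b.
-- (2) Choosing a tree of y for every vertex of a ∈ x and grafting recursively, (L/b)\R,
-- gives C(y)^deg(x) distinct elements of a × y; the degree of the left subtree of (L/b)\R
-- recovers the shape of a, so these families are disjoint for distinct a.
-- All cardinalities are computed from explicit lists: the Tamari order is decidable because
-- each rotation raises a potential bounded by the target tree.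
module Submission where

open import Defs
open import Data.Nat using (ℕ; zero; suc; _+_; _*_; _^_; _≤_; _<_; z≤n; s≤s)
open import Data.Nat.Properties
open import Data.List using (List; []; _∷_; [_]; length; map; concatMap; filter; _++_; deduplicate)
open import Data.List.Properties using (length-map; length-++)
open import Data.List.Membership.Propositional using (_∈_; _∉_; find; lose)
open import Data.List.Membership.Propositional.Properties
  using ( ∈-map⁺; ∈-map⁻; ∈-++⁺ˡ; ∈-++⁺ʳ; ∈-++⁻; ∈-filter⁺; ∈-filter⁻; ∈-deduplicate⁺; ∈-deduplicate⁻
        ; ∈-∃++; ∈-concatMap⁺; ∈-concatMap⁻)
open import Data.List.Relation.Unary.Any using (here; there; any?)
open import Data.List.Relation.Unary.All using (All; []; _∷_)
import Data.List.Relation.Unary.All as All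
open import Data.List.Relation.Unary.AllPairs using ([]; _∷_)
open import Data.List.Relation.Unary.Unique.Propositional using (Unique)
open import Data.List.Relation.Unary.Unique.DecPropositional.Properties using (deduplicate-!)
open import Data.List.Relation.Unary.Unique.Propositional.Properties using (++⁺; map⁺)
open import Data.List.Relation.Binary.Subset.Propositional using (_⊆_)
open import Data.Product using (∃-syntax; _×_; _,_; proj₁; proj₂)
open import Data.Sum using (_⊎_; inj₁; inj₂)
open import Data.Empty using (⊥; ⊥-elim)
open import Function using (_∘_)
open import Relation.Nullary using (¬_; Dec; yes; no)
open import Relation.Binary.Definitions using (DecidableEquality; tri<; tri≈; tri>)
open import Relation.Binary.Construct.Closure.ReflexiveTransitive using (Star; ε; _◅_; _◅◅_; gmap)
open import Relation.Binary.PropositionalEquality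
  using (_≡_; _≢_; refl; sym; trans; cong; cong₂; subst; module ≡-Reasoning)
open import Function.Bundles using (_⇔_; mk⇔; Equivalence)
open import Data.Nat.Tactic.RingSolver using (solve-∀)

node-injectiveˡ : ∀ {a b c d} → a ∨ b ≡ c ∨ d → a ≡ c
node-injectiveˡ refl = refl

node-injectiveʳ : ∀ {a b c d} → a ∨ b ≡ c ∨ d → b ≡ d
node-injectiveʳ refl = refl

_≟T_ : DecidableEquality Tree
leaf ≟T leaf = yes refl
leaf ≟T node _ _ = no λ ()
node _ _ ≟T leaf = no λ ()
node a b ≟T node c d with a ≟T c | b ≟T d
... | yes refl | yes refl = yes refl
... | no a≢c | _ = no (a≢c ∘ node-injectiveˡ)
... | yes _ | no b≢d = no (b≢d ∘ node-injectiveʳ)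

degree-over : ∀ x y → degree (x over y) ≡ degree x + degree y
degree-over x leaf = sym (+-identityʳ (degree x))
degree-over x (node l r) = begin
  suc (degree (x over l) + degree r)    ≡⟨ cong (λ k → suc (k + degree r)) (degree-over x l) ⟩
  suc (degree x + degree l + degree r)  ≡⟨ cong suc (+-assoc (degree x) (degree l) (degree r)) ⟩
  suc (degree x + (degree l + degree r)) ≡⟨ sym (+-suc (degree x) _) ⟩
  degree x + degree (node l r)          ∎
  where open ≡-Reasoning

degree-under : ∀ x y → degree (x under y) ≡ degree x + degree y
degree-under leaf y = refl
degree-under (node l r) y =
  cong suc (trans (cong (degree l +_) (degree-under r y)) (sym (+-assoc (degree l) (degree r) (degree y))))

leaf-over : ∀ y → leaf over y ≡ y
leaf-over leaf = refl
leaf-over (node l r) = cong (_∨ r) (leaf-over l)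

under-leaf : ∀ x → x under leaf ≡ x
under-leaf leaf = refl
under-leaf (node l r) = cong (l ∨_) (under-leaf r)

over-rotate : ∀ al ar b → (al ∨ ar) over b ≤T al ∨ (ar over b)
over-rotate al ar leaf = ≤T-refl
over-rotate al ar (node bl br) = ≤T-trans (≤T-congˡ (over-rotate al ar bl)) ≤T-rot

under-rotate : ∀ a bl br → (a under bl) ∨ br ≤T a under (bl ∨ br)
under-rotate leaf bl br = ≤T-refl
under-rotate (node al ar) bl br = ≤T-trans ≤T-rot (≤T-congʳ (under-rotate ar bl br))

over≤Tunder : ∀ x y → x over y ≤T x under y
over≤Tunder leaf y = subst (_≤T y) (sym (leaf-over y)) ≤T-refl
over≤Tunder (node xl xr) y = ≤T-trans (over-rotate xl xr y) (≤T-congʳ (over≤Tunder xr y))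

infix 4 _⟶_ _⟶*_

data _⟶_ : Tree → Tree → Set where
  rotate : ∀ {a b c} → (a ∨ b) ∨ c ⟶ a ∨ (b ∨ c)
  left   : ∀ {a a' b} → a ⟶ a' → a ∨ b ⟶ a' ∨ b
  right  : ∀ {a b b'} → b ⟶ b' → a ∨ b ⟶ a ∨ b'

_⟶*_ : Tree → Tree → Set
_⟶*_ = Star _⟶_

≤T⇒⟶* : ∀ {s t} → s ≤T t → s ⟶* t
≤T⇒⟶* ≤T-refl = ε
≤T⇒⟶* (≤T-trans p q) = ≤T⇒⟶* p ◅◅ ≤T⇒⟶* q
≤T⇒⟶* ≤T-rot = rotate ◅ ε
≤T⇒⟶* (≤T-congˡ p) = gmap (_∨ _) left (≤T⇒⟶* p)
≤T⇒⟶* (≤T-congʳ p) = gmap (_ ∨_) right (≤T⇒⟶* p)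

⟶⇒≤T : ∀ {s t} → s ⟶ t → s ≤T t
⟶⇒≤T rotate = ≤T-rot
⟶⇒≤T (left p) = ≤T-congˡ (⟶⇒≤T p)
⟶⇒≤T (right p) = ≤T-congʳ (⟶⇒≤T p)

⟶-degree : ∀ {s t} → s ⟶ t → degree s ≡ degree t
⟶-degree (rotate {a} {b} {c}) = rotation (degree a) (degree b) (degree c)
  where
  rotation : ∀ a b c → suc (suc (a + b) + c) ≡ suc (a + suc (b + c))
  rotation = solve-∀
⟶-degree (left p) = cong (λ k → suc (k + _)) (⟶-degree p)
⟶-degree (right {a} p) = cong (λ k → suc (degree a + k)) (⟶-degree p)

⟶*-degree : ∀ {s t} → s ⟶* t → degree s ≡ degree t
⟶*-degree ε = refl
⟶*-degree (p ◅ ps) = trans (⟶-degree p) (⟶*-degree ps)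

≤T-degree : ∀ {s t} → s ≤T t → degree s ≡ degree t
≤T-degree = ⟶*-degree ∘ ≤T⇒⟶*

potential : Tree → ℕ
potential leaf = 0
potential (node l r) = potential l + degree r + potential r

⟶-potential : ∀ {s t} → s ⟶ t → potential s < potential t
⟶-potential (rotate {a} {b} {c}) =
  subst (potential ((a ∨ b) ∨ c) <_)
        (rotation (potential a) (potential b) (potential c) (degree b) (degree c))
        (s≤s (m≤n+m _ (degree c)))
  where
  rotation : ∀ pa pb pc db dc → suc (dc + (pa + db + pb + dc + pc)) ≡ pa + suc (db + dc) + (pb + dc + pc)
  rotation = solve-∀
⟶-potential (left {b = b} p) = +-monoˡ-< (potential b) (+-monoˡ-< (degree b) (⟶-potential p))
⟶-potential (right {a} {b} {b'} p) =
  subst (λ k → potential a + degree b + potential b < potential a + k + potential b')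
        (⟶-degree p) (+-monoʳ-< (potential a + degree b) (⟶-potential p))

⟶*-potential : ∀ {s t} → s ⟶* t → potential s ≤ potential t
⟶*-potential ε = ≤-refl
⟶*-potential (p ◅ ps) = ≤-trans (<⇒≤ (⟶-potential p)) (⟶*-potential ps)

≤T-potential : ∀ {s t} → s ≤T t → potential s ≤ potential t
≤T-potential = ⟶*-potential ∘ ≤T⇒⟶*

≤T-antisym : ∀ {s t} → s ≤T t → t ≤T s → s ≡ t
≤T-antisym s≤t t≤s with ≤T⇒⟶* s≤t
... | ε = refl
... | p ◅ ps = ⊥-elim (<⇒≱ (<-≤-trans (⟶-potential p) (⟶*-potential ps)) (⟶*-potential (≤T⇒⟶* t≤s)))

∈-concatMap-intro : ∀ {A B : Set} (f : A → List B) {x xs y} → x ∈ xs → y ∈ f x → y ∈ concatMap f xs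
∈-concatMap-intro f x∈xs y∈fx = ∈-concatMap⁺ f (lose x∈xs y∈fx)

∈-concatMap-elim : ∀ {A B : Set} (f : A → List B) {xs y} → y ∈ concatMap f xs → ∃[ x ] (x ∈ xs × y ∈ f x)
∈-concatMap-elim f = find ∘ ∈-concatMap⁻ f

successors : Tree → List Tree
successors leaf = []
successors (node l r) = rotations l ++ map (_∨ r) (successors l) ++ map (l ∨_) (successors r)
  where
  rotations : Tree → List Tree
  rotations leaf = []
  rotations (node a b) = [ a ∨ (b ∨ r) ]

successors-sound : ∀ s {t} → t ∈ successors s → s ⟶ t
successors-sound (node (node a b) r) (here refl) = rotate
successors-sound (node leaf r) t∈ with ∈-++⁻ (map (_∨ r) (successors leaf)) t∈
... | inj₂ t∈r with ∈-map⁻ (leaf ∨_) t∈r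
...   | r' , r'∈ , refl = right (successors-sound r r'∈)
successors-sound (node (node a b) r) (there t∈) with ∈-++⁻ (map (_∨ r) (successors (node a b))) t∈
... | inj₁ t∈l with ∈-map⁻ (_∨ r) t∈l
...   | l' , l'∈ , refl = left (successors-sound (node a b) l'∈)
successors-sound (node (node a b) r) (there t∈) | inj₂ t∈r with ∈-map⁻ (node a b ∨_) t∈r
...   | r' , r'∈ , refl = right (successors-sound r r'∈)

successors-complete : ∀ {s t} → s ⟶ t → t ∈ successors s
successors-complete rotate = here refl
successors-complete (left {leaf} ())
successors-complete (left {node a b} {b = r} p) =
  there (∈-++⁺ˡ (∈-map⁺ (_∨ r) (successors-complete p)))
successors-complete (right {leaf} {b} p) =
  ∈-++⁺ʳ (map (_∨ b) (successors leaf)) (∈-map⁺ (leaf ∨_) (successors-complete p))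
successors-complete (right {node a a'} {b} p) =
  there (∈-++⁺ʳ (map (_∨ b) (successors (node a a'))) (∈-map⁺ (node a a' ∨_) (successors-complete p)))

reach : ℕ → Tree → List Tree
reach zero s = [ s ]
reach (suc k) s = s ∷ concatMap (reach k) (successors s)

reach-sound : ∀ k s {t} → t ∈ reach k s → s ≤T t
reach-sound zero s (here refl) = ≤T-refl
reach-sound (suc k) s (here refl) = ≤T-refl
reach-sound (suc k) s (there t∈) with ∈-concatMap-elim (reach k) t∈
... | m , m∈ , t∈m = ≤T-trans (⟶⇒≤T (successors-sound s m∈)) (reach-sound k m t∈m)

-- A path to t has at most (potential t ∸ potential s) steps.
reach-complete : ∀ k {s t} → s ⟶* t → potential t ≤ potential s + k → t ∈ reach k s
reach-complete zero ε _ = here refl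
reach-complete (suc k) ε _ = here refl
reach-complete zero {s} (p ◅ ps) bound =
  ⊥-elim (<⇒≱ (<-≤-trans (⟶-potential p) (⟶*-potential ps))
              (subst (_ ≤_) (+-identityʳ (potential s)) bound))
reach-complete (suc k) {s} {t} (_◅_ {j = m} p ps) bound =
  there (∈-concatMap-intro (reach k) (successors-complete p) (reach-complete k ps bound'))
  where
  bound' : potential t ≤ potential m + k
  bound' = ≤-trans bound
    (subst (_≤ potential m + k) (sym (+-suc (potential s) k)) (+-monoˡ-≤ k (⟶-potential p)))

_≤?T_ : ∀ s t → Dec (s ≤T t)
s ≤?T t with any? (t ≟T_) (reach (potential t) s)
... | yes t∈ = yes (reach-sound (potential t) s t∈)
... | no t∉ =
  no λ s≤t → t∉ (reach-complete (potential t) (≤T⇒⟶* s≤t) (m≤n+m (potential t) (potential s)))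

infix 4 _enumerates_

_enumerates_ : List Tree → TSet → Set
L enumerates P = (∀ {z} → z ∈ L → P z) × (∀ {z} → P z → z ∈ L)

IsCard-deduplicate : ∀ {L P} → L enumerates P → IsCard P (length (deduplicate _≟T_ L))
IsCard-deduplicate {L} (sound , complete) =
  deduplicate _≟T_ L , deduplicate-! _≟T_ L ,
  (λ z → mk⇔ (sound ∘ ∈-deduplicate⁻ _≟T_ L) (∈-deduplicate⁺ _≟T_ ∘ complete)) , refl

Unique-⊆⇒length≤ : ∀ {xs ys : List Tree} → Unique xs → xs ⊆ ys → length xs ≤ length ys
Unique-⊆⇒length≤ {[]} _ _ = z≤n
Unique-⊆⇒length≤ {x ∷ xs} {ys} (x∉xs ∷ u) xs⊆ys with ∈-∃++ (xs⊆ys (here refl))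
... | ys₁ , ys₂ , refl = subst (suc (length xs) ≤_) shorter (s≤s (Unique-⊆⇒length≤ u xs⊆ys₁++ys₂))
  where
  shorter : suc (length (ys₁ ++ ys₂)) ≡ length (ys₁ ++ x ∷ ys₂)
  shorter = begin
    suc (length (ys₁ ++ ys₂))         ≡⟨ cong suc (length-++ ys₁) ⟩
    suc (length ys₁ + length ys₂)     ≡⟨ sym (+-suc (length ys₁) (length ys₂)) ⟩
    length ys₁ + length (x ∷ ys₂)     ≡⟨ sym (length-++ ys₁) ⟩
    length (ys₁ ++ x ∷ ys₂)           ∎
    where open ≡-Reasoning
  xs⊆ys₁++ys₂ : xs ⊆ ys₁ ++ ys₂
  xs⊆ys₁++ys₂ {z} z∈xs with ∈-++⁻ ys₁ (xs⊆ys (there z∈xs))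
  ... | inj₁ z∈ys₁ = ∈-++⁺ˡ z∈ys₁
  ... | inj₂ (here refl) = ⊥-elim (All.lookup x∉xs z∈xs refl)
  ... | inj₂ (there z∈ys₂) = ∈-++⁺ʳ ys₁ z∈ys₂

IsCard-≥ : ∀ {P k E} → IsCard P k → Unique E → (∀ {z} → z ∈ E → P z) → length E ≤ k
IsCard-≥ (L , _ , L⇔P , refl) uE E⊆P =
  Unique-⊆⇒length≤ uE (λ {z} z∈E → Equivalence.from (L⇔P z) (E⊆P z∈E))

IsCard-≤ : ∀ {P k E} → IsCard P k → (∀ {z} → P z → z ∈ E) → k ≤ length E
IsCard-≤ (L , uL , L⇔P , refl) P⊆E =
  Unique-⊆⇒length≤ uL (λ {z} z∈L → P⊆E (Equivalence.to (L⇔P z) z∈L))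

IsCard-> : ∀ {P k E e} → IsCard P k → Unique E → (∀ {z} → z ∈ E → P z) → P e → e ∉ E → length E < k
IsCard-> isCard uE E⊆P Pe e∉E =
  IsCard-≥ isCard (All.tabulate (λ z∈E e≡z → e∉E (subst (_∈ _) (sym e≡z) z∈E)) ∷ uE)
    λ { (here refl) → Pe ; (there z∈E) → E⊆P z∈E }

module _ {A B : Set} where

  concatMap-unique : ∀ (f : A → List B) {xs} → Unique xs → (∀ {x} → x ∈ xs → Unique (f x)) →
    (∀ {x x' z} → x ∈ xs → x' ∈ xs → z ∈ f x → z ∈ f x' → x ≡ x') → Unique (concatMap f xs)
  concatMap-unique f {[]} _ _ _ = []
  concatMap-unique f {x ∷ xs} (x∉xs ∷ u) uf same =
    ++⁺ (uf (here refl)) (concatMap-unique f u (uf ∘ there) λ p q → same (there p) (there q)) disjoint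
    where
    disjoint : ∀ {z} → ¬ (z ∈ f x × z ∈ concatMap f xs)
    disjoint (z∈fx , z∈rest) with ∈-concatMap-elim f z∈rest
    ... | x' , x'∈xs , z∈fx' = All.lookup x∉xs x'∈xs (same (here refl) (there x'∈xs) z∈fx z∈fx')

  length-concatMap : ∀ (f : A → List B) {xs} c → (∀ {x} → x ∈ xs → length (f x) ≡ c) →
    length (concatMap f xs) ≡ length xs * c
  length-concatMap f {[]} c _ = refl
  length-concatMap f {x ∷ xs} c len =
    trans (length-++ (f x)) (cong₂ _+_ (len (here refl)) (length-concatMap f c (len ∘ there)))

liftList : (Tree → Tree → List Tree) → List Tree → List Tree → List Tree
liftList f xs ys = concatMap (λ a → concatMap (f a) ys) xs

∈-liftList⁺ : ∀ f {xs ys a b z} → a ∈ xs → b ∈ ys → z ∈ f a b → z ∈ liftList f xs ys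
∈-liftList⁺ f {ys = ys} a∈ b∈ z∈ =
  ∈-concatMap-intro (λ a → concatMap (f a) ys) a∈ (∈-concatMap-intro (f _) b∈ z∈)

∈-liftList⁻ : ∀ f {xs ys z} → z ∈ liftList f xs ys → ∃[ a ] ∃[ b ] (a ∈ xs × b ∈ ys × z ∈ f a b)
∈-liftList⁻ f {ys = ys} z∈ with ∈-concatMap-elim (λ a → concatMap (f a) ys) z∈
... | a , a∈ , z∈fa with ∈-concatMap-elim (f a) z∈fa
...   | b , b∈ , z∈fab = a , b , a∈ , b∈ , z∈fab

liftList-enumerates : ∀ {op f X Y xs ys} → (∀ a b → f a b enumerates op a b) →
  xs enumerates X → ys enumerates Y → liftList f xs ys enumerates liftS op X Y
liftList-enumerates {op} {f} {X} {Y} {xs} {ys} f-enum (xs-sound , xs-complete) (ys-sound , ys-complete) =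
  sound , complete
  where
  sound : ∀ {z} → z ∈ liftList f xs ys → liftS op X Y z
  sound z∈ with ∈-liftList⁻ f z∈
  ... | a , b , a∈ , b∈ , z∈fab = a , b , xs-sound a∈ , ys-sound b∈ , proj₁ (f-enum a b) z∈fab
  complete : ∀ {z} → liftS op X Y z → z ∈ liftList f xs ys
  complete (a , b , Xa , Yb , z∈) = ∈-liftList⁺ f (xs-complete Xa) (ys-complete Yb) (proj₂ (f-enum a b) z∈)

liftList-unique : ∀ f {xs ys} → Unique xs → Unique ys →
  (∀ {a b} → a ∈ xs → b ∈ ys → Unique (f a b)) →
  (∀ {a a' b b' z} → a ∈ xs → a' ∈ xs → b ∈ ys → b' ∈ ys →
     z ∈ f a b → z ∈ f a' b' → a ≡ a' × b ≡ b') →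
  Unique (liftList f xs ys)
liftList-unique f {ys = ys} uxs uys uf same =
  concatMap-unique (λ a → concatMap (f a) ys) uxs
    (λ a∈ → concatMap-unique (f _) uys (uf a∈) λ b∈ b'∈ z∈ z∈' →
      proj₂ (same a∈ a∈ b∈ b'∈ z∈ z∈'))
    λ a∈ a'∈ z∈ z∈' →
      let b , b∈ , z∈fab = ∈-concatMap-elim (f _) z∈
          b' , b'∈ , z∈fa'b' = ∈-concatMap-elim (f _) z∈'
      in proj₁ (same a∈ a'∈ b∈ b'∈ z∈fab z∈fa'b')

length-liftList : ∀ f xs ys c → (∀ {a b} → a ∈ xs → b ∈ ys → length (f a b) ≡ c) →
  length (liftList f xs ys) ≡ length xs * (length ys * c)
length-liftList f xs ys c len =
  length-concatMap (λ a → concatMap (f a) ys) (length ys * c)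
    (λ a∈ → length-concatMap (f _) c (len a∈))

interval : Tree → Tree → List Tree
interval a b = filter (_≤?T (a under b)) (reach (potential (a under b)) (a over b))

interval-enumerates : ∀ a b → interval a b enumerates sumT a b
interval-enumerates a b = sound , complete
  where
  sound : ∀ {z} → z ∈ interval a b → sumT a b z
  sound z∈ with ∈-filter⁻ (_≤?T (a under b)) {xs = reach (potential (a under b)) (a over b)} z∈
  ... | z∈reach , z≤ = reach-sound _ (a over b) z∈reach , z≤
  complete : ∀ {z} → sumT a b z → z ∈ interval a b
  complete (≤z , z≤) =
    ∈-filter⁺ (_≤?T (a under b))
      (reach-complete (potential (a under b)) (≤T⇒⟶* ≤z) (≤-trans (≤T-potential z≤) (m≤n+m _ _))) z≤

lsumList : Tree → Tree → List Tree
lsumList leaf b = [ leaf ]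
lsumList (node al ar) b = map (al ∨_) (interval ar b)

lsumList-enumerates : ∀ a b → lsumList a b enumerates lsumT a b
lsumList-enumerates leaf b = (λ { (here refl) → refl }) , (λ { refl → here refl })
lsumList-enumerates (node al ar) b = sound , complete
  where
  sound : ∀ {z} → z ∈ lsumList (node al ar) b → lsumT (node al ar) b z
  sound z∈ with ∈-map⁻ (al ∨_) z∈
  ... | w , w∈ , refl = w , proj₁ (interval-enumerates ar b) w∈ , refl
  complete : ∀ {z} → lsumT (node al ar) b z → z ∈ lsumList (node al ar) b
  complete (w , w∈ , refl) = ∈-map⁺ (al ∨_) (proj₂ (interval-enumerates ar b) w∈)

rsumList : Tree → Tree → List Tree
rsumList a leaf = [ leaf ]
rsumList a (node bl br) = map (_∨ br) (interval a bl)

rsumList-enumerates : ∀ a b → rsumList a b enumerates rsumT a b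
rsumList-enumerates a leaf = (λ { (here refl) → refl }) , (λ { refl → here refl })
rsumList-enumerates a (node bl br) = sound , complete
  where
  sound : ∀ {z} → z ∈ rsumList a (node bl br) → rsumT a (node bl br) z
  sound z∈ with ∈-map⁻ (_∨ br) z∈
  ... | w , w∈ , refl = w , proj₁ (interval-enumerates a bl) w∈ , refl
  complete : ∀ {z} → rsumT a (node bl br) z → z ∈ rsumList a (node bl br)
  complete (w , w∈ , refl) = ∈-map⁺ (_∨ br) (proj₂ (interval-enumerates a bl) w∈)

prodList : Tree → List Tree → List Tree
prodList leaf ys = []
prodList (node leaf leaf) ys = ys
prodList (node leaf (node c d)) ys = liftList lsumList ys (prodList (node c d) ys)
prodList (node (node a b) leaf) ys = liftList rsumList (prodList (node a b) ys) ys
prodList (node (node a b) (node c d)) ys =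
  liftList lsumList (liftList rsumList (prodList (node a b) ys) ys) (prodList (node c d) ys)

prodList-enumerates : ∀ {Y ys} → ys enumerates Y → ∀ a → prodList a ys enumerates prodT a Y
prodList-enumerates ys-enum leaf = (λ ()) , (λ ())
prodList-enumerates ys-enum (node leaf leaf) = ys-enum
prodList-enumerates ys-enum (node leaf (node c d)) =
  liftList-enumerates lsumList-enumerates ys-enum (prodList-enumerates ys-enum (node c d))
prodList-enumerates ys-enum (node (node a b) leaf) =
  liftList-enumerates rsumList-enumerates (prodList-enumerates ys-enum (node a b)) ys-enum
prodList-enumerates ys-enum (node (node a b) (node c d)) =
  liftList-enumerates lsumList-enumerates
    (liftList-enumerates rsumList-enumerates (prodList-enumerates ys-enum (node a b)) ys-enum)
    (prodList-enumerates ys-enum (node c d))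

prodSList-enumerates : ∀ {X Y xs ys} → xs enumerates X → ys enumerates Y →
  concatMap (λ a → prodList a ys) xs enumerates prodS X Y
prodSList-enumerates {X} {Y} {xs} {ys} (xs-sound , xs-complete) ys-enum = sound , complete
  where
  sound : ∀ {z} → z ∈ concatMap (λ a → prodList a ys) xs → prodS X Y z
  sound z∈ with ∈-concatMap-elim (λ a → prodList a ys) z∈
  ... | a , a∈ , z∈a = a , xs-sound a∈ , proj₁ (prodList-enumerates ys-enum a) z∈a
  complete : ∀ {z} → prodS X Y z → z ∈ concatMap (λ a → prodList a ys) xs
  complete (a , Xa , z∈) =
    ∈-concatMap-intro (λ a → prodList a ys) (xs-complete Xa) (proj₂ (prodList-enumerates ys-enum a) z∈)

trees-enumerates : ∀ x → trees x enumerates mem x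
trees-enumerates x = (λ z∈ → z∈) , (λ z∈ → z∈)

over-degree-cancel : ∀ {a a' b b'} → degree a ≡ degree a' → a over b ≡ a' over b' → degree b ≡ degree b'
over-degree-cancel {a} {a'} {b} {b'} da e = +-cancelˡ-≡ (degree a) _ _ (begin
  degree a + degree b    ≡⟨ sym (degree-over a b) ⟩
  degree (a over b)      ≡⟨ cong degree e ⟩
  degree (a' over b')    ≡⟨ degree-over a' b' ⟩
  degree a' + degree b'  ≡⟨ cong (_+ degree b') (sym da) ⟩
  degree a + degree b'   ∎)
  where open ≡-Reasoning

over-injective : ∀ {a a'} b b' → degree a ≡ degree a' → a over b ≡ a' over b' → a ≡ a' × b ≡ b'
over-injective leaf leaf _ e = e , refl
over-injective leaf (node _ _) da e = ⊥-elim (0≢1+n (over-degree-cancel da e))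
over-injective (node _ _) leaf da e = ⊥-elim (0≢1+n (sym (over-degree-cancel da e)))
over-injective (node bl br) (node bl' br') da e with over-injective bl bl' da (node-injectiveˡ e)
... | refl , refl = refl , cong (_ ∨_) (node-injectiveʳ e)

under-injective : ∀ a a' {b b'} → degree a ≡ degree a' → a under b ≡ a' under b' → a ≡ a' × b ≡ b'
under-injective leaf leaf _ e = refl , e
under-injective (node al ar) (node al' ar') da e with node-injectiveˡ e
... | refl with under-injective ar ar' (+-cancelˡ-≡ (degree al) _ _ (suc-injective da)) (node-injectiveʳ e)
...   | refl , refl = refl , refl

under-injectiveʳ : ∀ a {b b'} → a under b ≡ a under b' → b ≡ b'
under-injectiveʳ a = proj₂ ∘ under-injective a a refl

over≢under : ∀ u v u' v' → 1 ≤ degree v → 1 ≤ degree u' → degree u ≡ degree u' → u over v ≢ u' under v'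
over≢under u (node vl vr) (node ul' ur') v' _ _ du e = <-irrefl refl (begin-strict
  degree ul'                    <⟨ s≤s (m≤m+n (degree ul') (degree ur')) ⟩
  degree (node ul' ur')         ≡⟨ sym du ⟩
  degree u                      ≤⟨ m≤m+n (degree u) (degree vl) ⟩
  degree u + degree vl          ≡⟨ sym (degree-over u vl) ⟩
  degree (u over vl)            ≡⟨ cong degree (node-injectiveˡ e) ⟩
  degree ul'                    ∎)
  where open ≤-Reasoning

extremes : Tree → Tree → List Tree
extremes a b = a over b ∷ a under b ∷ []

extremes-unique : ∀ a b → 1 ≤ degree a → 1 ≤ degree b → Unique (extremes a b)
extremes-unique a b 1≤a 1≤b = (over≢under a b a b 1≤b 1≤a refl ∷ []) ∷ [] ∷ []

extremes-⊆-sumT : ∀ a b {z} → z ∈ extremes a b → sumT a b z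
extremes-⊆-sumT a b (here refl) = ≤T-refl , over≤Tunder a b
extremes-⊆-sumT a b (there (here refl)) = over≤Tunder a b , ≤T-refl

extremes-disjoint : ∀ {a a' b b' z} → 1 ≤ degree a → 1 ≤ degree a' → 1 ≤ degree b → 1 ≤ degree b' →
  degree a ≡ degree a' → z ∈ extremes a b → z ∈ extremes a' b' → a ≡ a' × b ≡ b'
extremes-disjoint {b = b} {b'} _ _ _ _ da (here refl) (here e) = over-injective b b' da e
extremes-disjoint {a} {a'} {b} {b'} _ 1≤a' 1≤b _ da (here refl) (there (here e)) =
  ⊥-elim (over≢under a b a' b' 1≤b 1≤a' da e)
extremes-disjoint {a} {a'} {b} {b'} 1≤a _ _ 1≤b' da (there (here refl)) (here e) =
  ⊥-elim (over≢under a' b' a b 1≤b' 1≤a (sym da) (sym e))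
extremes-disjoint {a} {a'} _ _ _ _ da (there (here refl)) (there (here e)) = under-injective a a' da e

over-rotated∉extremes : ∀ al ar b {a' b'} → 1 ≤ degree ar → 1 ≤ degree b → 1 ≤ degree a' → 1 ≤ degree b' →
  degree a' ≡ degree (al ∨ ar) → al ∨ (ar over b) ∉ extremes a' b'
over-rotated∉extremes al ar b {a'} {node b'l b'r} _ _ _ _ da (here e) = <-irrefl refl (begin-strict
  degree a'                    ≤⟨ m≤m+n (degree a') (degree b'l) ⟩
  degree a' + degree b'l       ≡⟨ sym (degree-over a' b'l) ⟩
  degree (a' over b'l)         ≡⟨ cong degree (node-injectiveˡ (sym e)) ⟩
  degree al                    <⟨ s≤s (m≤m+n (degree al) (degree ar)) ⟩
  degree (al ∨ ar)             ≡⟨ sym da ⟩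
  degree a'                    ∎)
  where open ≤-Reasoning
over-rotated∉extremes al ar b {node a'l a'r} {b'} 1≤ar 1≤b _ _ da (there (here e)) with node-injectiveˡ e
... | refl = over≢under ar b a'r b' 1≤b (subst (1 ≤_) dr 1≤ar) dr (node-injectiveʳ e)
  where
  dr : degree ar ≡ degree a'r
  dr = +-cancelˡ-≡ (degree al) _ _ (suc-injective (sym da))

under-rotated∉extremes : ∀ a bl br {a' b'} → 1 ≤ degree bl → 1 ≤ degree a → 1 ≤ degree a' → 1 ≤ degree b' →
  degree a' ≡ degree a → degree b' ≡ degree (bl ∨ br) → (a under bl) ∨ br ∉ extremes a' b'
under-rotated∉extremes a bl br {a'} {node b'l b'r} 1≤bl 1≤a _ _ da db (here e) with node-injectiveʳ e
... | refl = over≢under a' b'l a bl (subst (1 ≤_) dl 1≤bl) 1≤a da (sym (node-injectiveˡ e))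
  where
  dl : degree bl ≡ degree b'l
  dl = +-cancelʳ-≡ (degree br) _ _ (suc-injective (sym db))
under-rotated∉extremes a bl br {node a'l a'r} {b'} _ _ _ _ _ db (there (here e)) = <-irrefl refl (begin-strict
  degree b'                    ≤⟨ m≤n+m (degree b') (degree a'r) ⟩
  degree a'r + degree b'       ≡⟨ sym (degree-under a'r b') ⟩
  degree (a'r under b')        ≡⟨ cong degree (node-injectiveʳ (sym e)) ⟩
  degree br                    <⟨ s≤s (m≤n+m (degree br) (degree bl)) ⟩
  degree (bl ∨ br)             ≡⟨ sym db ⟩
  degree b'                    ∎)
  where open ≤-Reasoning

data LeftSpine : Tree → Tree → Set where
  here  : ∀ {t} → LeftSpine t t
  there : ∀ {l r t} → LeftSpine l t → LeftSpine (l ∨ r) t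

data RightSpine : Tree → Tree → Set where
  here  : ∀ {t} → RightSpine t t
  there : ∀ {l r t} → RightSpine r t → RightSpine (l ∨ r) t

LeftSpine-degree : ∀ {t u} → LeftSpine t u → degree u ≤ degree t
LeftSpine-degree here = ≤-refl
LeftSpine-degree (there {l} {r} p) = ≤-trans (LeftSpine-degree p) (m≤n⇒m≤1+n (m≤m+n (degree l) (degree r)))

RightSpine-degree : ∀ {t u} → RightSpine t u → degree u ≤ degree t
RightSpine-degree here = ≤-refl
RightSpine-degree (there {l} {r} p) = ≤-trans (RightSpine-degree p) (m≤n⇒m≤1+n (m≤n+m (degree r) (degree l)))

LeftSpine-unique : ∀ {t u v} → LeftSpine t u → LeftSpine t v → degree u ≡ degree v → u ≡ v
LeftSpine-unique here here _ = refl
LeftSpine-unique (there p) (there q) d = LeftSpine-unique p q d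
LeftSpine-unique here (there q) d = ⊥-elim (<⇒≢ (s≤s (≤-trans (LeftSpine-degree q) (m≤m+n _ _))) (sym d))
LeftSpine-unique (there p) here d = ⊥-elim (<⇒≢ (s≤s (≤-trans (LeftSpine-degree p) (m≤m+n _ _))) d)

RightSpine-unique : ∀ {t u v} → RightSpine t u → RightSpine t v → degree u ≡ degree v → u ≡ v
RightSpine-unique here here _ = refl
RightSpine-unique (there p) (there q) d = RightSpine-unique p q d
RightSpine-unique {node l r} here (there q) d =
  ⊥-elim (<⇒≢ (s≤s (≤-trans (RightSpine-degree q) (m≤n+m (degree r) (degree l)))) (sym d))
RightSpine-unique {node l r} (there p) here d =
  ⊥-elim (<⇒≢ (s≤s (≤-trans (RightSpine-degree p) (m≤n+m (degree r) (degree l)))) d)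

LeftSpine-antitone : ∀ {s t t'} → s ≤T t → LeftSpine t t' →
  ∃[ s' ] (LeftSpine s s' × degree s' ≡ degree t' × s' ≤T t')
LeftSpine-antitone {s} s≤t here = s , here , ≤T-degree s≤t , s≤t
LeftSpine-antitone ≤T-refl p = _ , p , refl , ≤T-refl
LeftSpine-antitone (≤T-trans s≤m m≤t) p with LeftSpine-antitone m≤t p
... | m' , pm , dm , m'≤ with LeftSpine-antitone s≤m pm
...   | s' , ps , ds , s'≤ = s' , ps , trans ds dm , ≤T-trans s'≤ m'≤
LeftSpine-antitone ≤T-rot (there p) = _ , there (there p) , refl , ≤T-refl
LeftSpine-antitone (≤T-congˡ s≤t) (there p) with LeftSpine-antitone s≤t p
... | s' , ps , ds , s'≤ = s' , there ps , ds , s'≤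
LeftSpine-antitone (≤T-congʳ _) (there p) = _ , there p , refl , ≤T-refl

RightSpine-monotone : ∀ {s t s'} → s ≤T t → RightSpine s s' →
  ∃[ t' ] (RightSpine t t' × degree t' ≡ degree s' × s' ≤T t')
RightSpine-monotone {t = t} s≤t here = t , here , sym (≤T-degree s≤t) , s≤t
RightSpine-monotone ≤T-refl p = _ , p , refl , ≤T-refl
RightSpine-monotone (≤T-trans s≤m m≤t) p with RightSpine-monotone s≤m p
... | m' , pm , dm , ≤m' with RightSpine-monotone m≤t pm
...   | t' , pt , dt , ≤t' = t' , pt , trans dt dm , ≤T-trans ≤m' ≤t'
RightSpine-monotone ≤T-rot (there p) = _ , there (there p) , refl , ≤T-refl
RightSpine-monotone (≤T-congˡ _) (there p) = _ , there p , refl , ≤T-refl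
RightSpine-monotone (≤T-congʳ s≤t) (there p) with RightSpine-monotone s≤t p
... | t' , pt , dt , ≤t' = t' , there pt , dt , ≤t'

LeftSpine-squeeze : ∀ {s z t u} → s ≤T z → z ≤T t → LeftSpine s u → LeftSpine t u → LeftSpine z u
LeftSpine-squeeze s≤z z≤t ps pt with LeftSpine-antitone z≤t pt
... | z' , pz , dz , z'≤u with LeftSpine-antitone s≤z pz
...   | s' , ps' , ds , s'≤z' with LeftSpine-unique ps ps' (sym (trans ds dz))
...     | refl = subst (LeftSpine _) (≤T-antisym z'≤u s'≤z') pz

RightSpine-squeeze : ∀ {s z t u} → s ≤T z → z ≤T t → RightSpine s u → RightSpine t u → RightSpine z u
RightSpine-squeeze s≤z z≤t ps pt with RightSpine-monotone s≤z ps
... | z' , pz , dz , u≤z' with RightSpine-monotone z≤t pz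
...   | t' , pt' , dt , z'≤t' with RightSpine-unique pt pt' (sym (trans dt dz))
...     | refl = subst (RightSpine _) (≤T-antisym z'≤t' u≤z') pz

degree≡0⇒leaf : ∀ {t} → degree t ≡ 0 → t ≡ leaf
degree≡0⇒leaf {leaf} _ = refl

excess-one : ∀ {a b c d} → a ≤ c → b ≤ d → c + d ≡ suc (a + b) → (c ≡ a × d ≡ suc b) ⊎ (c ≡ suc a × d ≡ b)
excess-one {zero} {c = zero} _ _ e = inj₁ (refl , e)
excess-one {zero} {b} {suc c} {d} _ b≤d e = inj₂ (cong suc c≡0 , d≡b)
  where
  d≡b : d ≡ b
  d≡b = ≤-antisym (subst (d ≤_) (suc-injective e) (m≤n+m d c)) b≤d
  c≡0 : c ≡ 0
  c≡0 = +-cancelʳ-≡ d c 0 (trans (suc-injective e) (sym d≡b))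
excess-one {suc a} {c = suc c} (s≤s a≤c) b≤d e with excess-one a≤c b≤d (suc-injective e)
... | inj₁ (refl , d≡1+b) = inj₁ (refl , d≡1+b)
... | inj₂ (refl , d≡b) = inj₂ (refl , d≡b)

LeftSpine-suc : ∀ {t u} → LeftSpine t u → degree t ≡ suc (degree u) → t ≡ u ∨ leaf
LeftSpine-suc here d = ⊥-elim (<-irrefl d ≤-refl)
LeftSpine-suc {node l r} {u} (there p) d = cong₂ _∨_ (LeftSpine-unique here p l≡u) (degree≡0⇒leaf r≡0)
  where
  r≡0 : degree r ≡ 0
  r≡0 = n≤0⇒n≡0 (+-cancelˡ-≤ (degree l) _ _ (begin
    degree l + degree r  ≡⟨ suc-injective d ⟩
    degree u             ≤⟨ LeftSpine-degree p ⟩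
    degree l             ≡⟨ sym (+-identityʳ (degree l)) ⟩
    degree l + 0         ∎))
    where open ≤-Reasoning
  l≡u : degree l ≡ degree u
  l≡u = trans (sym (+-identityʳ (degree l))) (trans (cong (degree l +_) (sym r≡0)) (suc-injective d))

RightSpine-suc : ∀ {t u} → RightSpine t u → degree t ≡ suc (degree u) → t ≡ leaf ∨ u
RightSpine-suc here d = ⊥-elim (<-irrefl d ≤-refl)
RightSpine-suc {node l r} {u} (there p) d = cong₂ _∨_ (degree≡0⇒leaf l≡0) (RightSpine-unique here p r≡u)
  where
  l≡0 : degree l ≡ 0
  l≡0 = n≤0⇒n≡0 (+-cancelʳ-≤ (degree r) _ _ (begin
    degree l + degree r  ≡⟨ suc-injective d ⟩
    degree u             ≤⟨ RightSpine-degree p ⟩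
    degree r             ∎))
    where open ≤-Reasoning
  r≡u : degree r ≡ degree u
  r≡u = trans (cong (_+ degree r) (sym l≡0)) (suc-injective d)

LeftSpine-proper : ∀ {l r u} → LeftSpine (l ∨ r) u → degree u < degree (l ∨ r) → LeftSpine l u
LeftSpine-proper here lt = ⊥-elim (<-irrefl refl lt)
LeftSpine-proper (there p) _ = p

RightSpine-proper : ∀ {l r u} → RightSpine (l ∨ r) u → degree u < degree (l ∨ r) → RightSpine r u
RightSpine-proper here lt = ⊥-elim (<-irrefl refl lt)
RightSpine-proper (there p) _ = p

spines-determine : ∀ {al br zl zr} → LeftSpine zl al → RightSpine zr br →
  degree zl + degree zr ≡ suc (degree al + degree br) →
  zl ∨ zr ≡ (al ∨ leaf) ∨ br ⊎ zl ∨ zr ≡ al ∨ (leaf ∨ br)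
spines-determine pl pr d with excess-one (LeftSpine-degree pl) (RightSpine-degree pr) d
... | inj₁ (zl≡al , zr≡1+br) = inj₂ (cong₂ _∨_ (LeftSpine-unique here pl zl≡al) (RightSpine-suc pr zr≡1+br))
... | inj₂ (zl≡1+al , zr≡br) = inj₁ (cong₂ _∨_ (LeftSpine-suc pl zl≡1+al) (RightSpine-unique here pr zr≡br))

inherited-interval : ∀ al br {z} → (al ∨ leaf) ∨ br ≤T z → z ≤T al ∨ (leaf ∨ br) →
  z ≡ (al ∨ leaf) ∨ br ⊎ z ≡ al ∨ (leaf ∨ br)
inherited-interval al br {leaf} P≤z _ = ⊥-elim (0≢1+n (sym (≤T-degree P≤z)))
inherited-interval al br {node zl zr} P≤z z≤Q =
  spines-determine
    (LeftSpine-proper (LeftSpine-squeeze P≤z z≤Q (there (there here)) (there here))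
                      (subst (degree al <_) d al<P))
    (RightSpine-proper (RightSpine-squeeze P≤z z≤Q (there here) (there (there here)))
                       (subst (degree br <_) d br<P))
    (trans (suc-injective (sym d)) (cong (λ k → suc (k + degree br)) (+-identityʳ (degree al))))
  where
  d : degree ((al ∨ leaf) ∨ br) ≡ degree (zl ∨ zr)
  d = ≤T-degree P≤z
  al<P : degree al < degree ((al ∨ leaf) ∨ br)
  al<P = <-trans (s≤s (m≤m+n (degree al) 0)) (s≤s (m≤m+n _ (degree br)))
  br<P : degree br < degree ((al ∨ leaf) ∨ br)
  br<P = s≤s (m≤n+m (degree br) _)

degree-∈ : ∀ x {t} → t ∈ trees x → degree t ≡ deg x
degree-∈ x = All.lookup (degrees x)

positive-∈ : ∀ x {t} → 1 ≤ deg x → t ∈ trees x → 1 ≤ degree t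
positive-∈ x 1≤x t∈ = subst (1 ≤_) (sym (degree-∈ x t∈)) 1≤x

some-∈ : ∀ x → ∃[ t ] (t ∈ trees x)
some-∈ x with trees x | nonempty x
... | [] | nonempty = ⊥-elim (nonempty refl)
... | t ∷ _ | _ = t , here refl

module SumCount (x y : Grove) (1≤x : 1 ≤ deg x) (1≤y : 1 ≤ deg y) where

  S : TSet
  S = sumS (mem x) (mem y)

  E : List Tree
  E = liftList extremes (trees x) (trees y)

  card : IsCard S (length (deduplicate _≟T_ (liftList interval (trees x) (trees y))))
  card = IsCard-deduplicate (liftList-enumerates interval-enumerates (trees-enumerates x) (trees-enumerates y))

  E-unique : Unique E
  E-unique = liftList-unique extremes (unique x) (unique y)
    (λ a∈ b∈ → extremes-unique _ _ (positive-∈ x 1≤x a∈) (positive-∈ y 1≤y b∈))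
    λ a∈ a'∈ b∈ b'∈ → extremes-disjoint (positive-∈ x 1≤x a∈) (positive-∈ x 1≤x a'∈)
      (positive-∈ y 1≤y b∈) (positive-∈ y 1≤y b'∈) (trans (degree-∈ x a∈) (sym (degree-∈ x a'∈)))

  E-length : length E ≡ 2 * C x * C y
  E-length = trans (length-liftList extremes (trees x) (trees y) 2 (λ _ _ → refl)) (arith (C x) (C y))
    where
    arith : ∀ m n → m * (n * 2) ≡ 2 * m * n
    arith = solve-∀

  E⊆S : ∀ {z} → z ∈ E → S z
  E⊆S z∈ with ∈-liftList⁻ extremes z∈
  ... | a , b , a∈ , b∈ , z∈ab = a , b , a∈ , b∈ , extremes-⊆-sumT a b z∈ab

  inherited⇒S⊆E : LeftInherited x → RightInherited y → ∀ {z} → S z → z ∈ E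
  inherited⇒S⊆E li ri (a , b , a∈ , b∈ , a/b≤z , z≤a\b) with All.lookup li a∈ | All.lookup ri b∈
  ... | al , refl | br , refl with inherited-interval al br a/b≤z z≤a\b
  ...   | inj₁ refl = ∈-liftList⁺ extremes a∈ b∈ (here refl)
  ...   | inj₂ refl = ∈-liftList⁺ extremes a∈ b∈ (there (here refl))

  module _ {k} (isCard : IsCard S k) where

    lower-bound : 2 * C x * C y ≤ k
    lower-bound = subst (_≤ k) E-length (IsCard-≥ isCard E-unique E⊆S)

    inherited⇒tight : LeftInherited x → RightInherited y → k ≡ 2 * C x * C y
    inherited⇒tight li ri =
      ≤-antisym (subst (k ≤_) E-length (IsCard-≤ isCard (inherited⇒S⊆E li ri))) lower-bound

    tight⇒no-extra-element : k ≡ 2 * C x * C y → ∀ {e} → S e → e ∉ E → ⊥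
    tight⇒no-extra-element tight Se e∉E = <-irrefl (trans E-length (sym tight)) (IsCard-> isCard E-unique E⊆S Se e∉E)

    tight⇒left-inherited : k ≡ 2 * C x * C y → LeftInherited x
    tight⇒left-inherited tight = All.tabulate inherited
      where
      inherited : ∀ {a} → a ∈ trees x → LeftInheritedT a
      inherited {leaf} a∈ with () ← positive-∈ x 1≤x a∈
      inherited {node al leaf} _ = al , refl
      inherited {node al ar@(node _ _)} a∈ with some-∈ y
      ... | b , b∈ = ⊥-elim (tight⇒no-extra-element tight Se e∉E)
        where
        Se : S (al ∨ (ar over b))
        Se = _ , b , a∈ , b∈ , over-rotate al ar b , ≤T-congʳ (over≤Tunder ar b)
        e∉E : al ∨ (ar over b) ∉ E
        e∉E e∈E with ∈-liftList⁻ extremes e∈E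
        ... | a' , b' , a'∈ , b'∈ , e∈a'b' =
          over-rotated∉extremes al ar b (s≤s z≤n) (positive-∈ y 1≤y b∈) (positive-∈ x 1≤x a'∈)
            (positive-∈ y 1≤y b'∈) (trans (degree-∈ x a'∈) (sym (degree-∈ x a∈))) e∈a'b'

    tight⇒right-inherited : k ≡ 2 * C x * C y → RightInherited y
    tight⇒right-inherited tight = All.tabulate inherited
      where
      inherited : ∀ {b} → b ∈ trees y → RightInheritedT b
      inherited {leaf} b∈ with () ← positive-∈ y 1≤y b∈
      inherited {node leaf br} _ = br , refl
      inherited {node bl@(node _ _) br} b∈ with some-∈ x
      ... | a , a∈ = ⊥-elim (tight⇒no-extra-element tight Se e∉E)
        where
        Se : S ((a under bl) ∨ br)
        Se = a , _ , a∈ , b∈ , ≤T-congˡ (over≤Tunder a bl) , under-rotate a bl br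
        e∉E : (a under bl) ∨ br ∉ E
        e∉E e∈E with ∈-liftList⁻ extremes e∈E
        ... | a' , b' , a'∈ , b'∈ , e∈a'b' =
          under-rotated∉extremes a bl br (s≤s z≤n) (positive-∈ x 1≤x a∈) (positive-∈ x 1≤x a'∈)
            (positive-∈ y 1≤y b'∈) (trans (degree-∈ x a'∈) (sym (degree-∈ x a∈)))
            (trans (degree-∈ y b'∈) (sym (degree-∈ y b∈))) e∈a'b'

sandwich : Tree → Tree → Tree → Tree
sandwich L b R = (L over b) under R

degree-sandwich : ∀ L b R → degree (sandwich L b R) ≡ degree L + degree b + degree R
degree-sandwich L b R = trans (degree-under (L over b) R) (cong (_+ degree R) (degree-over L b))

sandwich-injective : ∀ {L L' b b' R R'} → degree L ≡ degree L' → degree b ≡ degree b' →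
  sandwich L b R ≡ sandwich L' b' R' → L ≡ L' × b ≡ b' × R ≡ R'
sandwich-injective {L} {L'} {b} {b'} dL db e
  with under-injective (L over b) (L' over b')
         (trans (degree-over L b) (trans (cong₂ _+_ dL db) (sym (degree-over L' b')))) e
... | e' , refl with over-injective b b' dL e'
...   | refl , refl = refl , refl , refl

under∈lsumT : ∀ u R → 1 ≤ degree u → lsumT u R (u under R)
under∈lsumT (node ul ur) R _ = ur under R , (over≤Tunder ur R , ≤T-refl) , refl

over∈rsumT : ∀ L b → 1 ≤ degree b → rsumT L b (L over b)
over∈rsumT L (node bl br) _ = L over bl , (≤T-refl , over≤Tunder L bl) , refl

smaller-quotient-< : ∀ q {m m' r r'} → r < q → m < m' → q * m + r < q * m' + r'
smaller-quotient-< q {m} {m'} {r} {r'} r<q m<m' = begin-strict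
  q * m + r     <⟨ +-monoʳ-< (q * m) r<q ⟩
  q * m + q     ≡⟨ +-comm (q * m) q ⟩
  q + q * m     ≡⟨ sym (*-suc q m) ⟩
  q * suc m     ≤⟨ *-monoʳ-≤ q m<m' ⟩
  q * m'        ≤⟨ m≤m+n (q * m') r' ⟩
  q * m' + r'   ∎
  where open ≤-Reasoning

quotient-unique : ∀ q {m m' r r'} → r < q → r' < q → q * m + r ≡ q * m' + r' → m ≡ m'
quotient-unique q {m} {m'} r<q r'<q e with <-cmp m m'
... | tri< m<m' _ _ = ⊥-elim (<-irrefl e (smaller-quotient-< q r<q m<m'))
... | tri≈ _ m≡m' _ = m≡m'
... | tri> _ _ m>m' = ⊥-elim (<-irrefl (sym e) (smaller-quotient-< q r'<q m>m'))

sandwiches : List Tree → Tree → Tree → List Tree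
sandwiches Rs L b = map (sandwich L b) Rs

module Canonical (y : Grove) (1≤y : 1 ≤ deg y) where

  canonical : Tree → List Tree
  canonical leaf = [ leaf ]
  canonical (node l r) = liftList (sandwiches (canonical r)) (canonical l) (trees y)

  ∈-canonical⁻ : ∀ l r {z} → z ∈ canonical (l ∨ r) →
    ∃[ L ] ∃[ b ] ∃[ R ] (L ∈ canonical l × b ∈ trees y × R ∈ canonical r × z ≡ sandwich L b R)
  ∈-canonical⁻ l r z∈ with ∈-liftList⁻ (sandwiches (canonical r)) z∈
  ... | L , b , L∈ , b∈ , z∈LbR with ∈-map⁻ (sandwich L b) z∈LbR
  ...   | R , R∈ , refl = L , b , R , L∈ , b∈ , R∈ , refl

  canonical-length : ∀ a → length (canonical a) ≡ C y ^ degree a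
  canonical-length leaf = refl
  canonical-length (node l r) = begin
    length (canonical (l ∨ r))
      ≡⟨ length-liftList (sandwiches (canonical r)) (canonical l) (trees y) (length (canonical r))
           (λ _ _ → length-map _ (canonical r)) ⟩
    length (canonical l) * (C y * length (canonical r))
      ≡⟨ cong₂ (λ u v → u * (C y * v)) (canonical-length l) (canonical-length r) ⟩
    C y ^ degree l * (C y * C y ^ degree r)
      ≡⟨ swap (C y ^ degree l) (C y) (C y ^ degree r) ⟩
    C y * (C y ^ degree l * C y ^ degree r)
      ≡⟨ cong (C y *_) (sym (^-distribˡ-+-* (C y) (degree l) (degree r))) ⟩
    C y ^ degree (l ∨ r) ∎
    where
    open ≡-Reasoning
    swap : ∀ u n v → u * (n * v) ≡ n * (u * v)
    swap = solve-∀

  canonical-degree : ∀ a {z} → z ∈ canonical a → degree z ≡ deg y * degree a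
  canonical-degree leaf (here refl) = sym (*-zeroʳ (deg y))
  canonical-degree (node l r) z∈ with ∈-canonical⁻ l r z∈
  ... | L , b , R , L∈ , b∈ , R∈ , refl = begin
    degree (sandwich L b R)
      ≡⟨ degree-sandwich L b R ⟩
    degree L + degree b + degree R
      ≡⟨ cong₂ _+_ (cong₂ _+_ (canonical-degree l L∈) (degree-∈ y b∈)) (canonical-degree r R∈) ⟩
    deg y * degree l + deg y + deg y * degree r
      ≡⟨ distrib (deg y) (degree l) (degree r) ⟩
    deg y * degree (l ∨ r) ∎
    where
    open ≡-Reasoning
    distrib : ∀ q u v → q * u + q + q * v ≡ q * suc (u + v)
    distrib = solve-∀

  positive-over : ∀ L {b} → b ∈ trees y → 1 ≤ degree (L over b)
  positive-over L {b} b∈ =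
    subst (1 ≤_) (sym (degree-over L b)) (≤-trans (positive-∈ y 1≤y b∈) (m≤n+m (degree b) (degree L)))

  canonical-⊆-prodT : ∀ a {z} → 1 ≤ degree a → z ∈ canonical a → prodT a (mem y) z
  sandwich∈prodT : ∀ l r {L b R} → L ∈ canonical l → b ∈ trees y → R ∈ canonical r →
    prodT (l ∨ r) (mem y) (sandwich L b R)

  canonical-⊆-prodT (node l r) _ z∈ with ∈-canonical⁻ l r z∈
  ... | L , b , R , L∈ , b∈ , R∈ , refl = sandwich∈prodT l r L∈ b∈ R∈

  sandwich∈prodT leaf leaf {b = b} (here refl) b∈ (here refl) =
    subst (_∈ trees y) (sym (trans (under-leaf (leaf over b)) (leaf-over b))) b∈
  sandwich∈prodT leaf r@(node _ _) {b = b} {R} (here refl) b∈ R∈ =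
    subst (λ t → prodT (leaf ∨ r) (mem y) (t under R)) (sym (leaf-over b))
      (b , R , b∈ , canonical-⊆-prodT r (s≤s z≤n) R∈ , under∈lsumT b R (positive-∈ y 1≤y b∈))
  sandwich∈prodT l@(node _ _) leaf {L} {b} L∈ b∈ (here refl) =
    subst (prodT (l ∨ leaf) (mem y)) (sym (under-leaf (L over b)))
      (L , b , canonical-⊆-prodT l (s≤s z≤n) L∈ , b∈ , over∈rsumT L b (positive-∈ y 1≤y b∈))
  sandwich∈prodT l@(node _ _) r@(node _ _) {L} {b} {R} L∈ b∈ R∈ =
    L over b , R ,
    (L , b , canonical-⊆-prodT l (s≤s z≤n) L∈ , b∈ , over∈rsumT L b (positive-∈ y 1≤y b∈)) ,
    canonical-⊆-prodT r (s≤s z≤n) R∈ , under∈lsumT (L over b) R (positive-over L b∈)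

  sandwich-canonical-injective : ∀ {l l' L L' b b' R R'} → degree l ≡ degree l' →
    L ∈ canonical l → L' ∈ canonical l' → b ∈ trees y → b' ∈ trees y →
    sandwich L b R ≡ sandwich L' b' R' → L ≡ L' × b ≡ b' × R ≡ R'
  sandwich-canonical-injective {l} {l'} dl L∈ L'∈ b∈ b'∈ =
    sandwich-injective
      (trans (canonical-degree l L∈) (trans (cong (deg y *_) dl) (sym (canonical-degree l' L'∈))))
      (trans (degree-∈ y b∈) (sym (degree-∈ y b'∈)))

  canonical-unique : ∀ a → Unique (canonical a)
  canonical-unique leaf = [] ∷ []
  canonical-unique (node l r) =
    liftList-unique (sandwiches (canonical r)) (canonical-unique l) (unique y)
      (λ {L} {b} _ _ → map⁺ (under-injectiveʳ (L over b)) (canonical-unique r)) same-root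
    where
    same-root : ∀ {L L' b b' z} → L ∈ canonical l → L' ∈ canonical l → b ∈ trees y → b' ∈ trees y →
      z ∈ sandwiches (canonical r) L b → z ∈ sandwiches (canonical r) L' b' → L ≡ L' × b ≡ b'
    same-root {L} {L'} {b} {b'} L∈ L'∈ b∈ b'∈ z∈ z∈'
      with ∈-map⁻ (sandwich L b) z∈ | ∈-map⁻ (sandwich L' b') z∈'
    ... | R , _ , refl | R' , _ , e with sandwich-canonical-injective {l} {l} refl L∈ L'∈ b∈ b'∈ e
    ...   | L≡L' , b≡b' , _ = L≡L' , b≡b'

  -- The left subtree of (L/b)\R has degree deg L + deg bl with deg bl < deg y, which recovers deg l.
  sandwich-left-degree : ∀ {l l' L L' b b' R R'} → L ∈ canonical l → L' ∈ canonical l' →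
    b ∈ trees y → b' ∈ trees y → sandwich L b R ≡ sandwich L' b' R' → degree l ≡ degree l'
  sandwich-left-degree {b = leaf} _ _ b∈ _ _ with () ← positive-∈ y 1≤y b∈
  sandwich-left-degree {b' = leaf} _ _ _ b'∈ _ with () ← positive-∈ y 1≤y b'∈
  sandwich-left-degree {l} {l'} {L} {L'} {node bl br} {node bl' br'} L∈ L'∈ b∈ b'∈ e =
    quotient-unique (deg y) (remainder b∈) (remainder b'∈) (begin
      deg y * degree l + degree bl     ≡⟨ cong (_+ degree bl) (sym (canonical-degree l L∈)) ⟩
      degree L + degree bl             ≡⟨ sym (degree-over L bl) ⟩
      degree (L over bl)               ≡⟨ cong degree (node-injectiveˡ e) ⟩
      degree (L' over bl')             ≡⟨ degree-over L' bl' ⟩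
      degree L' + degree bl'           ≡⟨ cong (_+ degree bl') (canonical-degree l' L'∈) ⟩
      deg y * degree l' + degree bl'   ∎)
    where
    open ≡-Reasoning
    remainder : ∀ {bl br} → bl ∨ br ∈ trees y → degree bl < deg y
    remainder {bl} {br} b∈ = subst (degree bl <_) (degree-∈ y b∈) (s≤s (m≤m+n (degree bl) (degree br)))

  canonical-disjoint : ∀ a a' {z} → degree a ≡ degree a' → z ∈ canonical a → z ∈ canonical a' → a ≡ a'
  canonical-disjoint leaf leaf _ _ _ = refl
  canonical-disjoint (node l r) (node l' r') da z∈ z∈'
    with ∈-canonical⁻ l r z∈ | ∈-canonical⁻ l' r' z∈'
  ... | L , b , R , L∈ , b∈ , R∈ , refl | L' , b' , R' , L'∈ , b'∈ , R'∈ , e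
    with sandwich-left-degree L∈ L'∈ b∈ b'∈ e
  ... | dl with sandwich-canonical-injective dl L∈ L'∈ b∈ b'∈ e
  ...   | refl , refl , refl = cong₂ _∨_ (canonical-disjoint l l' dl L∈ L'∈) (canonical-disjoint r r' dr R∈ R'∈)
    where
    dr : degree r ≡ degree r'
    dr = +-cancelˡ-≡ (degree l) _ _ (trans (suc-injective da) (cong (_+ degree r') (sym dl)))

module ProductCount (x y : Grove) (1≤x : 1 ≤ deg x) (1≤y : 1 ≤ deg y) where

  open Canonical y 1≤y

  P : TSet
  P = prodS (mem x) (mem y)

  card : IsCard P (length (deduplicate _≟T_ (concatMap (λ a → prodList a (trees y)) (trees x))))
  card = IsCard-deduplicate (prodSList-enumerates (trees-enumerates x) (trees-enumerates y))

  E : List Tree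
  E = concatMap canonical (trees x)

  E-unique : Unique E
  E-unique = concatMap-unique canonical (unique x) (λ {a} _ → canonical-unique a)
    λ {a} {a'} a∈ a'∈ → canonical-disjoint a a' (trans (degree-∈ x a∈) (sym (degree-∈ x a'∈)))

  E-length : length E ≡ C x * C y ^ deg x
  E-length = length-concatMap canonical (C y ^ deg x)
    λ {a} a∈ → trans (canonical-length a) (cong (C y ^_) (degree-∈ x a∈))

  E⊆P : ∀ {z} → z ∈ E → P z
  E⊆P z∈ with ∈-concatMap-elim canonical z∈
  ... | a , a∈ , z∈a = a , a∈ , canonical-⊆-prodT a (positive-∈ x 1≤x a∈) z∈a

  lower-bound : ∀ {m} → IsCard P m → C x * C y ^ deg x ≤ m
  lower-bound {m} isCard = subst (_≤ m) E-length (IsCard-≥ isCard E-unique E⊆P)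

mainTheorem2 : (x y : Grove) → 1 ≤ deg x → 1 ≤ deg y →
    (∃[ k ] (IsCard (sumS (mem x) (mem y)) k × 2 * C x * C y ≤ k ×
        ((k ≡ 2 * C x * C y) ⇔ (LeftInherited x × RightInherited y))))
    × (∃[ m ] (IsCard (prodS (mem x) (mem y)) m × C x * C y ^ deg x ≤ m))
mainTheorem2 x y 1≤x 1≤y =
  (_ , Sum.card , Sum.lower-bound Sum.card ,
    mk⇔ (λ tight → Sum.tight⇒left-inherited Sum.card tight , Sum.tight⇒right-inherited Sum.card tight)
        (λ (li , ri) → Sum.inherited⇒tight Sum.card li ri)) ,
  (_ , Product.card , Product.lower-bound Product.card)
  where
  module Sum = SumCount x y 1≤x 1≤y
  module Product = ProductCount x y 1≤x 1≤y
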